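{- Let $\mathcal{F}=\langle E,H,\sim\rangle$ be an ETL frame (a single tree) in which $\sim$ is transitive and Euclidean. If $\sim$ has $\mathsf{PR_{hc}^\ell}$, then so does $\dot\sim$, the smallest equivalence relation on $H$ containing $\sim$ (i.e. the S5 closure of $\mathcal{F}$ has $\mathsf{PR_{hc}^\ell}$).
   Context: Fix a finite set $E$ of events; histories are finite sequences of events, $\epsilon$ the empty history. Write $h\leadsto h'$ if $h'=he$ for some event $e$. A protocol $H$ is a finite prefix-closed set of histories (a tree rooted at $\epsilon$). An ETL frame is $\langle E,H,\sim\rangle$ with $\sim\subseteq H\times H$. Euclidean: $h\sim h'$ and $h\sim h''$ imply $h'\sim h''$. A relation $R$ on $H$ has $\mathsf{PR_{hc}^\ell}$ iff for all $h,h'$ and events $e$ with $he\,R\,h'$: (i) $h\,R\,h'$, or (ii) $h\,R\,h''\leadsto h'$ for some $h''$, or (iii) $he\,R\,h''\leadsto h'$ for some $h''$. -}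

module Defs where

open import Level using (Level; _⊔_; suc)
open import Data.List using (List; []; _∷_; _∷ʳ_)
open import Data.List.Membership.Propositional using (_∈_)
open import Data.Product using (Σ; ∃; ∃-syntax; _×_; _,_)
open import Data.Sum using (_⊎_)
open import Relation.Binary.PropositionalEquality using (_≡_)

History : Set → Set
History E = List E

_⇝_ : {E : Set} → History E → History E → Set
_⇝_ {E} h h' = Σ E λ e → h' ≡ h ∷ʳ e

record Protocol (E : Set) : Set₁ where
  field
    member      : History E → Set
    hasEmpty    : member []
    prefixClosed : ∀ h e → member (h ∷ʳ e) → member h
    finite      : Σ (List (History E)) λ hs → ∀ h → member h → h ∈ hs

record ETLFrame : Set₁ where
  field
    Event     : Set
    events    : List Event
    eventsAll : ∀ e → e ∈ events
    H         : Protocol Event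
    _∼_       : History Event → History Event → Set
    ∼⊆H×H     : ∀ {h h'} → h ∼ h' → Protocol.member H h × Protocol.member H h'

module _ {E : Set} where

  Transitive : (History E → History E → Set) → Set
  Transitive R = ∀ {h h' h''} → R h h' → R h' h'' → R h h''

  Euclidean : (History E → History E → Set) → Set
  Euclidean R = ∀ {h h' h''} → R h h' → R h h'' → R h' h''

  PRhcℓ : (History E → History E → Set) → Set
  PRhcℓ R = ∀ h h' (e : E) → R (h ∷ʳ e) h' →
      R h h'
    ⊎ (∃[ h'' ] (R h h'' × h'' ⇝ h'))
    ⊎ (∃[ h'' ] (R (h ∷ʳ e) h'' × h'' ⇝ h'))

  data EqClosure (mem : History E → Set) (R : History E → History E → Set)
       : History E → History E → Set where
    base  : ∀ {h h'} → R h h' → EqClosure mem R h h'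
    refl' : ∀ {h} → mem h → EqClosure mem R h h
    sym'  : ∀ {h h'} → EqClosure mem R h h' → EqClosure mem R h' h
    trans' : ∀ {h h' h''} → EqClosure mem R h h' → EqClosure mem R h' h'' →
             EqClosure mem R h h''

-- For a transitive Euclidean ∼, two histories are equivalent in the S5 closure iff
-- they are equal (and in H) or both ∼-related to a common w.  So it suffices to
-- prove PRhcℓ for this "joined" relation.  Applying PRhcℓ of ∼ repeatedly (its third
-- alternative strictly shortens the right-hand side) to h e ∼ w and h′ ∼ w reduces
-- every case to one of the three alternatives, except when h′ = []; there an
-- induction on length shows that h ∼ r together with [] ∼ r g already join h and [].

module Submission where

open import Defs
open import Data.List using ([]; _∷ʳ_; length; initLast; _∷ʳ′_)
open import Data.List.Properties using (length-++; ∷ʳ-injectiveˡ)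
open import Data.Nat using (_≤_; _<_; z<s)
open import Data.Nat.Properties using (≤-refl; ≤-trans; <⇒≤; <-≤-trans; m<m+n)
open import Data.Nat.Induction using (<-wellFounded)
open import Data.Product using (∃-syntax; _×_; _,_)
import Data.Product as Prod
open import Data.Sum using (_⊎_; inj₁; inj₂)
import Data.Sum as Sum
open import Induction.WellFounded using (Acc; acc; WellFounded)
import Relation.Binary.Construct.On as On
open import Relation.Binary.PropositionalEquality using (_≡_; refl; sym; subst)

module _ {E : Set} where

  _⊏_ : History E → History E → Set
  xs ⊏ ys = length xs < length ys

  ⊏-wellFounded : WellFounded _⊏_
  ⊏-wellFounded = On.wellFounded length <-wellFounded

  ⇝⇒⊏ : ∀ {r c : History E} → r ⇝ c → r ⊏ c
  ⇝⇒⊏ {r} (_ , refl) = subst (length r <_) (sym (length-++ r)) (m<m+n (length r) z<s)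

  _⇝⁼_ : History E → History E → Set
  r ⇝⁼ c = r ≡ c ⊎ r ⇝ c

  ⇝⁼⇒≤ : ∀ {r c : History E} → r ⇝⁼ c → length r ≤ length c
  ⇝⁼⇒≤ (inj₁ refl) = ≤-refl
  ⇝⁼⇒≤ (inj₂ r⇝c)  = <⇒≤ (⇝⇒⊏ r⇝c)

  Joined : (History E → History E → Set) → History E → History E → Set
  Joined R x y = ∃[ w ] (R x w × R y w)

module _ {E : Set} {_∼_ : History E → History E → Set} (pr : PRhcℓ _∼_) where

  snoc-∼-retract : ∀ {h e c} → (h ∷ʳ e) ∼ c →
    ∃[ c′ ] (length c′ ≤ length c × (h ∷ʳ e) ∼ c′ × ∃[ r ] (h ∼ r × r ⇝⁼ c′))
  snoc-∼-retract {h} {e} {c} hec = go c (⊏-wellFounded c) hec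
    where
    go : ∀ c → Acc _⊏_ c → (h ∷ʳ e) ∼ c →
      ∃[ c′ ] (length c′ ≤ length c × (h ∷ʳ e) ∼ c′ × ∃[ r ] (h ∼ r × r ⇝⁼ c′))
    go c (acc rec) hec with pr h c e hec
    ... | inj₁ hc                  = c , ≤-refl , hec , c , hc , inj₁ refl
    ... | inj₂ (inj₁ (r , hr , rc)) = c , ≤-refl , hec , r , hr , inj₂ rc
    ... | inj₂ (inj₂ (r , her , rc)) =
      let c′ , c′≤r , rest = go r (rec (⇝⇒⊏ rc)) her
      in  c′ , ≤-trans c′≤r (<⇒≤ (⇝⇒⊏ rc)) , rest

  ∼-root : ∀ {x w} → x ∼ w → ∃[ p ] (length p ≤ length w × [] ∼ p)
  ∼-root {x} = go x (⊏-wellFounded x)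
    where
    go : ∀ x → Acc _⊏_ x → ∀ {w} → x ∼ w → ∃[ p ] (length p ≤ length w × [] ∼ p)
    go x (acc rec) {w} xw with initLast x
    ... | []      = w , ≤-refl , xw
    ... | k ∷ʳ′ f with snoc-∼-retract xw
    ...   | c′ , c′≤w , _ , r , kr , r⇝⁼c′ =
      let p , p≤r , []p = go k (rec (⇝⇒⊏ {r = k} (f , refl))) kr
      in  p , ≤-trans p≤r (≤-trans (⇝⁼⇒≤ r⇝⁼c′) c′≤w) , []p

  snoc-∼-snoc : ∀ {r g s f} → (r ∷ʳ g) ∼ (s ∷ʳ f) → r ∼ (s ∷ʳ f) ⊎ r ∼ s ⊎ (r ∷ʳ g) ∼ s
  snoc-∼-snoc {r} {g} {s} {f} rgsf with pr r (s ∷ʳ f) g rgsf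
  ... | inj₁ rsf                      = inj₁ rsf
  ... | inj₂ (inj₁ (t , rt , _ , eq)) = inj₂ (inj₁ (subst (r ∼_) (sym (∷ʳ-injectiveˡ s t eq)) rt))
  ... | inj₂ (inj₂ (t , rgt , _ , eq)) = inj₂ (inj₂ (subst ((r ∷ʳ g) ∼_) (sym (∷ʳ-injectiveˡ s t eq)) rgt))

module _ {E : Set} {_∼_ : History E → History E → Set}
         (∼-trans : Transitive _∼_) (∼-euclid : Euclidean _∼_) where

  Joined-sym : ∀ {x y} → Joined _∼_ x y → Joined _∼_ y x
  Joined-sym (w , xw , yw) = w , yw , xw

  Joined-∼ : ∀ {x y v} → Joined _∼_ x y → x ∼ v → y ∼ v
  Joined-∼ (w , xw , yw) xv = ∼-trans yw (∼-euclid xw xv)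

  Joined-trans : ∀ {x y z} → Joined _∼_ x y → Joined _∼_ y z → Joined _∼_ x z
  Joined-trans (w , xw , yw) (v , yv , zv) = v , Joined-∼ (Joined-sym (w , xw , yw)) yv , zv

  module _ {mem : History E → Set} where

    Joined⇒EqClosure : ∀ {x y} → Joined _∼_ x y → EqClosure mem _∼_ x y
    Joined⇒EqClosure (w , xw , yw) = trans' (base xw) (sym' (base yw))

    EqClosure⇒≡⊎Joined : ∀ {x y} → EqClosure mem _∼_ x y → (x ≡ y × mem x) ⊎ Joined _∼_ x y
    EqClosure⇒≡⊎Joined (base xy)    = inj₂ (_ , xy , ∼-euclid xy xy)
    EqClosure⇒≡⊎Joined (refl' mx)   = inj₁ (refl , mx)
    EqClosure⇒≡⊎Joined (sym' c) with EqClosure⇒≡⊎Joined c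
    ... | inj₁ (refl , mx) = inj₁ (refl , mx)
    ... | inj₂ j           = inj₂ (Joined-sym j)
    EqClosure⇒≡⊎Joined (trans' c d) with EqClosure⇒≡⊎Joined c | EqClosure⇒≡⊎Joined d
    ... | inj₁ (refl , _) | d′              = d′
    ... | inj₂ j          | inj₁ (refl , _) = inj₂ j
    ... | inj₂ j          | inj₂ k          = inj₂ (Joined-trans j k)

  module _ (pr : PRhcℓ _∼_) where

    -- Induction on |r|: ∼-root supplies a witness p of [] no longer than r, and
    -- retracting r ∷ʳ g ∼ p either joins h and [] or yields a shorter instance.
    Joined-root : ∀ {h r g} → [] ∼ (r ∷ʳ g) → h ∼ r → Joined _∼_ h []
    Joined-root {h} {r} = go r (⊏-wellFounded r)
      where
      go : ∀ r → Acc _⊏_ r → ∀ {g} → [] ∼ (r ∷ʳ g) → h ∼ r → Joined _∼_ h []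
      go r (acc rec) []rg hr with ∼-root pr hr
      ... | p , p≤r , []p with snoc-∼-retract pr (∼-euclid []rg []p)
      ...   | c′ , c′≤p , rgc′ , r′ , rr′ , inj₁ refl =
              c′ , ∼-trans hr rr′ , ∼-trans []rg rgc′
      ...   | c′ , c′≤p , rgc′ , r′ , rr′ , inj₂ r′⇝c′ =
              go r′ (rec (<-≤-trans (⇝⇒⊏ r′⇝c′) (≤-trans c′≤p p≤r)))
                 (subst ([] ∼_) (Prod.proj₂ r′⇝c′) (∼-trans []rg rgc′)) (∼-trans hr rr′)

    Joined-PRhcℓ : PRhcℓ (Joined _∼_)
    Joined-PRhcℓ h h′ e j@(w , hew , h′w) with snoc-∼-retract pr hew
    ... | c₁ , _ , hec₁ , r , hr , inj₁ refl = inj₁ (c₁ , hr , Joined-∼ j hec₁)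
    ... | c₁ , _ , hec₁ , r , hr , inj₂ (g , refl) with initLast h′
    ...   | []      = inj₁ (Joined-root (Joined-∼ j hec₁) hr)
    ...   | k ∷ʳ′ f with snoc-∼-retract pr h′w
    ...     | c₂ , _ , h′c₂ , r₂ , kr₂ , inj₁ refl =
              inj₂ (inj₂ (k , (c₂ , Joined-∼ (Joined-sym j) h′c₂ , kr₂) , f , refl))
    ...     | c₂ , _ , h′c₂ , r₂ , kr₂ , inj₂ (g₂ , refl)
      with snoc-∼-snoc pr (∼-euclid hec₁ (Joined-∼ (Joined-sym j) h′c₂))
    ...       | inj₁ rc₂          = inj₁ (c₂ , ∼-trans hr rc₂ , h′c₂)
    ...       | inj₂ (inj₁ rr₂)  = inj₂ (inj₁ (k , (r₂ , ∼-trans hr rr₂ , kr₂) , f , refl))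
    ...       | inj₂ (inj₂ rgr₂) = inj₂ (inj₂ (k , (r₂ , ∼-trans hec₁ rgr₂ , kr₂) , f , refl))

lemma3 : (F : ETLFrame) →
    Transitive (ETLFrame._∼_ F) → Euclidean (ETLFrame._∼_ F) →
    PRhcℓ (ETLFrame._∼_ F) →
    PRhcℓ (EqClosure (Protocol.member (ETLFrame.H F)) (ETLFrame._∼_ F))
lemma3 F ∼-trans ∼-euclid pr h h′ e he≈h′
  with EqClosure⇒≡⊎Joined ∼-trans ∼-euclid he≈h′
... | inj₁ (refl , m) = inj₂ (inj₁ (h , refl' (Protocol.prefixClosed (ETLFrame.H F) h e m) , e , refl))
... | inj₂ j          =
  Sum.map J⇒C (Sum.map (Prod.map₂ (Prod.map₁ J⇒C)) (Prod.map₂ (Prod.map₁ J⇒C)))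
    (Joined-PRhcℓ ∼-trans ∼-euclid pr h h′ e j)
  where J⇒C = Joined⇒EqClosure ∼-trans ∼-euclid
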